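{- Let $\mathcal{X}=(X_a:a\in A)$ be a partition of the ground set of a matroid $M$. For $k\in\mathbb{N}$ let $M_k$ be the matroid obtained from $M$ by applying the guts projection operation with respect to $\mathcal{X}$ $k$ times (so $M_0=M$ and $M_{k+1}$ is the guts projection of $\mathcal{X}$ in $M_k$). Then $\lambda_{M^*}(\mathcal{X})$ equals the minimum $k\in\mathbb{N}$ such that $\lambda_{M_k}(\mathcal{X})=0$, or $\infty$ if no such $k$ exists.
   Context: Matroids are possibly infinite (in the sense of Bruhn, Diestel, Kriesell, Pendavingh and Wollan); ranks take values in $\mathbb{N}\cup\{\infty\}$. For a partition $(X_a:a\in A)$ of $E(M)$, $\lambda_M((X_a))=r^*(M|\bigcup_a I_a)$ where $I_a$ is a basis for $X_a$ for each $a$ (independent of the choices). For $F\subseteq E(M)$, $M/\!\!/F=(M/F)\oplus O_F$ with $O_F$ the rank-zero matroid on $F$. A family $(X_a)$ is skew in $M$ if there is an independent set $B$ with $B\cap X_a$ a basis for $X_a$ for each $a$, and $X_a\cap X_b\subseteq\mathrm{cl}_M(\varnothing)$ for distinct $a,b$. The guts cut $\mathcal{G}$ of the partition $\mathcal{X}$ in $M$ is the collection of flats $F$ of $M$ for which $\mathcal{X}$ is skew in $M/\!\!/F$; it is a modular cut, so for $e\notin E(M)$ there is a unique matroid $M'$ with $M'\setminus e=M$ such that a flat $F$ of $M$ satisfies $e\in\mathrm{cl}_{M'}(F)$ iff $F\in\mathcal{G}$. The guts projection of $\mathcal{X}$ in $M$ is $M'/e$. -}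

module Defs where

open import Level using (Level; 0ℓ) renaming (suc to lsuc)
open import Data.Nat using (ℕ; zero; suc; _<_)
open import Data.Maybe using (Maybe; just; nothing)
open import Data.Empty using (⊥)
open import Data.Unit using (⊤)
open import Data.Product using (Σ; ∃; ∃-syntax; _×_; _,_)
open import Data.Sum using (_⊎_)
open import Data.List using (List; length)
open import Data.List.Membership.Propositional using (_∈_)
open import Data.List.Relation.Unary.Unique.Propositional using (Unique)
open import Relation.Nullary using (¬_)
open import Relation.Binary.PropositionalEquality using (_≡_; _≢_)
open import Function.Bundles using (_⇔_)

Sub : Set → Set₁
Sub E = E → Set

module _ {E : Set} where

  ∅ : Sub E
  ∅ _ = ⊥

  full : Sub E
  full _ = ⊤

  ∁ : Sub E → Sub E
  ∁ X x = ¬ X x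

  _⊆_ : Sub E → Sub E → Set
  X ⊆ Y = ∀ x → X x → Y x

  _∪_ : Sub E → Sub E → Sub E
  (X ∪ Y) x = X x ⊎ Y x

  _∩_ : Sub E → Sub E → Sub E
  (X ∩ Y) x = X x × Y x

  ｛_｝ : E → Sub E
  ｛ e ｝ x = x ≡ e

  Disjoint : Sub E → Sub E → Set
  Disjoint X Y = ∀ x → X x → Y x → ⊥

  ⋃ : {A : Set} → (A → Sub E) → Sub E
  ⋃ {A} I x = Σ A λ a → I a x

IndSys : Set → Set₂
IndSys E = Sub E → Set₁

module _ {E : Set} (ind : IndSys E) where

  IsBasisOf : Sub E → Sub E → Set₁
  IsBasisOf X B = (B ⊆ X) × ind B ×
    (∀ B′ → B ⊆ B′ → B′ ⊆ X → ind B′ → B′ ⊆ B)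

  IsMaximal : Sub E → Set₁
  IsMaximal = IsBasisOf full

-- Matroids in the sense of Bruhn, Diestel, Kriesell, Pendavingh, Wollan
-- (independence axioms I1, I2, I3, IM).

record Matroid (E : Set) : Set₂ where
  field
    ind : IndSys E
    I1  : ind ∅
    I2  : ∀ I J → ind J → I ⊆ J → ind I
    I3  : ∀ I I′ → ind I → ¬ IsMaximal ind I → IsMaximal ind I′ →
          ∃[ x ] (I′ x × ¬ I x × ind (I ∪ ｛ x ｝))
    IM  : ∀ I X → ind I → I ⊆ X →
          ∃[ B ] ((I ⊆ B) × (B ⊆ X) × ind B ×
                  (∀ B′ → B ⊆ B′ → B′ ⊆ X → ind B′ → B′ ⊆ B))

open Matroid public

module _ {E : Set} where

  dualInd : IndSys E → IndSys E
  dualInd ind I = ∃[ B ] (IsMaximal ind B × Disjoint I B)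

  -- restriction M|Y, viewed on E with E∖Y as loops
  restrictInd : IndSys E → Sub E → IndSys E
  restrictInd ind Y I = (I ⊆ Y) × ind I

  -- M//F = (M/F) ⊕ O_F where M/F = (M* \ F)*.
  -- (M* \ F ⊕ loops on F)* = M/F ⊕ coloops on F; intersecting with
  -- "disjoint from F" turns the elements of F into loops.
  contractInd : IndSys E → Sub E → IndSys E
  contractInd ind F I =
    Disjoint I F × dualInd (restrictInd (dualInd ind) (∁ F)) I

  InCl : IndSys E → Sub E → E → Set₁
  InCl ind X e = Lift′ (X e) ⊎ ∃[ I ] ((I ⊆ X) × ind I × ¬ ind (I ∪ ｛ e ｝))
    where
    Lift′ : Set → Set₁
    Lift′ P = Level.Lift (lsuc 0ℓ) P

  IsFlat : IndSys E → Sub E → Set₁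
  IsFlat ind F = ∀ e → InCl ind F e → F e

  Skew : {A : Set} → IndSys E → (A → Sub E) → Set₁
  Skew {A} ind X =
    (∃[ B ] (ind B × (∀ a → IsBasisOf ind (X a) (B ∩ X a)))) ×
    (∀ a b → a ≢ b → ∀ x → (X a ∩ X b) x → InCl ind ∅ x)

  InGutsCut : {A : Set} → IndSys E → (A → Sub E) → Sub E → Set₁
  InGutsCut ind X F = IsFlat ind F × Skew (contractInd ind F) X

  -- partition of E indexed by A (parts may be empty)
  IsPartition : {A : Set} → (A → Sub E) → Set
  IsPartition {A} X =
    (∀ e → ∃[ a ] X a e) × (∀ a b e → X a e → X b e → a ≡ b)

-- lifting a subset of E to a subset of E + e  (e = nothing)
liftSub : {E : Set} → Sub E → Sub (Maybe E)
liftSub X nothing  = ⊥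
liftSub X (just x) = X x

-- N is the guts projection of X in M: there is M′ on E + e with
-- M′ \ e = M, e ∈ cl_{M′}(F) iff F ∈ guts cut (for flats F of M),
-- and N = M′ / e.
IsGutsProjection : {E A : Set} → Matroid E → (A → Sub E) → Matroid E → Set₂
IsGutsProjection {E} M X N =
  ∃[ M′ ] (
    (∀ I → ind M I ⇔ ind M′ (liftSub I)) ×
    (∀ F → IsFlat (ind M) F →
       (InCl (ind M′) (liftSub F) nothing ⇔ InGutsCut (ind M) X F)) ×
    (∀ I → ind N I ⇔ contractInd (ind M′) ｛ nothing ｝ (liftSub I)))

data ℕ∞ : Set where
  fin : ℕ → ℕ∞
  ∞   : ℕ∞

module _ {E : Set} where

  HasSize : Sub E → ℕ → Set
  HasSize P n = ∃[ xs ] (Unique xs × (∀ x → P x ⇔ (x ∈ xs)) × length xs ≡ n)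

  HasCard : Sub E → ℕ∞ → Set
  HasCard P (fin n) = HasSize P n
  HasCard P ∞       = ∀ n → ¬ HasSize P n

  HasRank : IndSys E → Sub E → ℕ∞ → Set₁
  HasRank ind X v = ∃[ B ] (IsBasisOf ind X B × HasCard B v)

  -- λ_M(X) = v :  r*(M | ⋃ I_a) = v for bases I_a of X_a
  -- (r* of M|Y computed as the rank of Y in (M|Y ⊕ loops)*)
  LambdaIs : {A : Set} → IndSys E → (A → Sub E) → ℕ∞ → Set₁
  LambdaIs {A} ind X v =
    ∃[ I ] ((∀ a → IsBasisOf ind (X a) (I a)) ×
            HasRank (dualInd (restrictInd ind (⋃ I))) (⋃ I) v)

MinZeroSpec : {E A : Set} → (ℕ → Matroid E) → (A → Sub E) → ℕ∞ → Set₁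
MinZeroSpec Ms X (fin n) =
  LambdaIs (ind (Ms n)) X (fin 0) ×
  (∀ k → k < n → ¬ LambdaIs (ind (Ms k)) X (fin 0))
MinZeroSpec Ms X ∞ = ∀ k → ¬ LambdaIs (ind (Ms k)) X (fin 0)

{-# OPTIONS --safe #-}
-- Let J be the union of cobases J a of the parts X a, and B₀ a basis of E ∖ J. Then λ_{M*}(X) = |S|
-- for any S ⊆ J such that B₀ ∪ S is a basis of M. If S = ∅, then B₀ is a basis meeting every part in
-- a basis of it, so λ_M(X) = 0. If S ≠ ∅, skewness of X in M // F for a flat F ⊇ E ∖ J would force
-- F = E, so the new element e of the guts projection is not in cl(E ∖ J); in particular cl(∅) is
-- not in the guts cut, that is λ_M(X) ≠ 0. On the other hand X is skew in M // cl(E ∖ X a), so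
-- e ∈ cl(E ∖ X a) and every J a remains a cobasis of X a after contracting e, while B₀ remains a
-- basis of E ∖ J. A basis of B₀ ∪ S + e through B₀ + e misses exactly one element of S, so the
-- guts projection lowers λ_{M*}(X) by one, and induction along the sequence gives the theorem.
module Submission where

open import Defs
open import Level using (0ℓ; lift; lower) renaming (suc to lsuc)
open import Axiom.ExcludedMiddle using (ExcludedMiddle)
open import Data.Nat using (ℕ; zero; suc; s≤s)
open import Data.Nat.Properties using (suc-injective)
open import Data.Product using (Σ; ∃; ∃-syntax; _×_; _,_; proj₁; proj₂)
open import Data.Sum using (_⊎_; inj₁; inj₂)
open import Data.Empty using (⊥; ⊥-elim)
open import Data.Unit using (tt)
open import Data.Maybe using (Maybe; just; nothing)
open import Data.Maybe.Properties using (just-injective)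
open import Data.List using (List; []; _∷_; length)
open import Data.List.Membership.Propositional using (_∈_)
open import Data.List.Relation.Unary.Any using (here; there)
open import Data.List.Relation.Unary.All as All using ()
open import Data.List.Relation.Unary.Unique.Propositional using (Unique)
open import Data.List.Relation.Unary.AllPairs using ([]; _∷_)
open import Function using (_∘_; case_of_)
open import Function.Bundles using (_⇔_; mk⇔; Equivalence)
open import Relation.Nullary using (¬_; Dec; yes; no)
open import Relation.Nullary.Decidable using (True; toWitness; fromWitness; map′; decidable-stable)
open import Relation.Binary.PropositionalEquality using (_≡_; _≢_; refl; sym; trans; subst; cong)

module _ (em : ExcludedMiddle (lsuc (lsuc 0ℓ))) where

  dec : (P : Set) → Dec P
  dec P = map′ lower lift em

  dec₁ : (P : Set₁) → Dec P
  dec₁ P = map′ lower lift em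

  by-contradiction : {P : Set} → ¬ ¬ P → P
  by-contradiction = decidable-stable (dec _)

  by-contradiction₁ : {P : Set₁} → ¬ ¬ P → P
  by-contradiction₁ = decidable-stable (dec₁ _)

  module _ {E : Set} where

    _-_ : Sub E → E → Sub E
    (X - x) y = X y × y ≢ x

    insert-⊆ : {I Z : Sub E} {x : E} → I ⊆ Z → Z x → (I ∪ ｛ x ｝) ⊆ Z
    insert-⊆ I⊆Z _   y (inj₁ y∈I) = I⊆Z y y∈I
    insert-⊆ _   x∈Z y (inj₂ refl) = x∈Z

    insert-mono : {I J : Sub E} {x : E} → I ⊆ J → (I ∪ ｛ x ｝) ⊆ (J ∪ ｛ x ｝)
    insert-mono I⊆J y (inj₁ y∈I) = inj₁ (I⊆J y y∈I)
    insert-mono _   y (inj₂ y≡x) = inj₂ y≡x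

    module _ (P : IndSys E) where

      basis-absorbs : {Y K : Sub E} {x : E} → IsBasisOf P Y K → Y x → P (K ∪ ｛ x ｝) → K x
      basis-absorbs (K⊆Y , _ , max) x∈Y iKx = max _ (λ _ → inj₁) (insert-⊆ K⊆Y x∈Y) iKx _ (inj₂ refl)

      self-basis : {I : Sub E} → P I → IsBasisOf P I I
      self-basis iI = (λ _ x∈I → x∈I) , iI , λ _ _ B⊆I _ → B⊆I

      not-maximal : {K : Sub E} {x : E} → ¬ K x → P (K ∪ ｛ x ｝) → ¬ IsMaximal P K
      not-maximal x∉K iKx maxK = x∉K (basis-absorbs maxK tt iKx)

      restrict-maximal⇒basis : {Y C : Sub E} → IsMaximal (restrictInd P Y) C → IsBasisOf P Y C
      restrict-maximal⇒basis (_ , (C⊆Y , iC) , max) =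
        C⊆Y , iC , λ C′ C⊆C′ C′⊆Y iC′ → max C′ C⊆C′ (λ _ _ → tt) (C′⊆Y , iC′)

      basis⇒restrict-maximal : {Y C : Sub E} → IsBasisOf P Y C → IsMaximal (restrictInd P Y) C
      basis⇒restrict-maximal (C⊆Y , iC , max) =
        (λ _ _ → tt) , (C⊆Y , iC) , λ C′ C⊆C′ _ (C′⊆Y , iC′) → max C′ C⊆C′ C′⊆Y iC′

      restrict-dual-basis-intro : {Y C S : Sub E} → IsBasisOf P Y C → S ⊆ Y → Disjoint S C →
                                  (∀ x → Y x → ¬ C x → S x) → IsBasisOf (dualInd (restrictInd P Y)) Y S
      restrict-dual-basis-intro {Y} {C} {S} C-basis@(C⊆Y , iC , _) S⊆Y S∩C=∅ Y∖C⊆S =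
        S⊆Y , (C , basis⇒restrict-maximal C-basis , S∩C=∅) , absorb
        where
        absorb : ∀ S′ → S ⊆ S′ → S′ ⊆ Y → dualInd (restrictInd P Y) S′ → S′ ⊆ S
        absorb S′ S⊆S′ S′⊆Y (C′ , (_ , (C′⊆Y , _) , absorbC′) , S′∩C′=∅) x x∈S′ with dec (C x)
        ... | no x∉C  = Y∖C⊆S x (S′⊆Y x x∈S′) x∉C
        ... | yes x∈C = ⊥-elim (S′∩C′=∅ x x∈S′ (absorbC′ C C′⊆C (λ _ _ → tt) (C⊆Y , iC) x x∈C))
          where
          C′⊆C : C′ ⊆ C
          C′⊆C c c∈C′ = by-contradiction λ c∉C →
            S′∩C′=∅ c (S⊆S′ c (Y∖C⊆S c (C′⊆Y c c∈C′) c∉C)) c∈C′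

      restrict-dual-basis-elim : {Y S : Sub E} → IsBasisOf (dualInd (restrictInd P Y)) Y S →
                                 Σ (Sub E) λ C → IsBasisOf P Y C × Disjoint S C × (∀ x → Y x → ¬ C x → S x)
      restrict-dual-basis-elim {Y} (S⊆Y , (C , maxC , S∩C=∅) , max) =
        C , restrict-maximal⇒basis maxC , S∩C=∅ ,
        λ x x∈Y x∉C → max (λ z → Y z × ¬ C z) (λ z z∈S → S⊆Y z z∈S , S∩C=∅ z z∈S) (λ _ → proj₁)
                          (C , maxC , λ _ → proj₂) x (x∈Y , x∉C)

  module _ {E : Set} where

    lift-mono : {Y Z : Sub E} → Y ⊆ Z → liftSub Y ⊆ liftSub Z
    lift-mono Y⊆Z (just x) = Y⊆Z x

    unlift-⊆ : {Z : Sub (Maybe E)} → liftSub (Z ∘ just) ⊆ Z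
    unlift-⊆ (just x) x∈Z = x∈Z

    unlift-insert-⊆ : {Z : Sub (Maybe E)} → Z nothing → (liftSub (Z ∘ just) ∪ ｛ nothing ｝) ⊆ Z
    unlift-insert-⊆ _   (just x) (inj₁ x∈Z) = x∈Z
    unlift-insert-⊆ e∈Z _        (inj₂ refl) = e∈Z

  -- Cardinalities

  module _ {E : Set} where

    HasSize-0⇒empty : {P : Sub E} → HasSize P 0 → ∀ x → ¬ P x
    HasSize-0⇒empty ([] , _ , P⇔∈ , _) x x∈P with Equivalence.to (P⇔∈ x) x∈P
    ... | ()

    empty⇒HasSize-0 : {P : Sub E} → (∀ x → ¬ P x) → HasSize P 0
    empty⇒HasSize-0 P=∅ = [] , [] , (λ x → mk⇔ (⊥-elim ∘ P=∅ x) λ ()) , refl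

    HasSize-suc⇒nonempty : {P : Sub E} {n : ℕ} → HasSize P (suc n) → Σ E P
    HasSize-suc⇒nonempty (x ∷ _ , _ , P⇔∈ , _) = x , Equivalence.from (P⇔∈ x) (here refl)

    HasCard-∞⇒nonempty : {P : Sub E} → HasCard P ∞ → Σ E P
    HasCard-∞⇒nonempty infinite =
      by-contradiction λ P=∅ → infinite 0 (empty⇒HasSize-0 λ x x∈P → P=∅ (x , x∈P))

    HasCard-exists : (P : Sub E) → ∃ (HasCard P)
    HasCard-exists P with dec (Σ ℕ (HasSize P))
    ... | yes (n , P-size) = fin n , P-size
    ... | no infinite      = ∞ , λ n P-size → infinite (n , P-size)

    HasSize-insert : {P : Sub E} {x : E} {n : ℕ} → P x → HasSize (P - x) n → HasSize P (suc n)
    HasSize-insert {P} {x} x∈P (xs , unique , P-x⇔∈ , refl) =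
      x ∷ xs , All.tabulate (λ y∈xs x≡y → proj₂ (from (P-x⇔∈ _) y∈xs) (sym x≡y)) ∷ unique ,
      (λ y → mk⇔ (to′ y) (from′ y)) , refl
      where
      open Equivalence
      to′ : ∀ y → P y → y ∈ (x ∷ xs)
      to′ y y∈P with dec (y ≡ x)
      ... | yes y≡x = here y≡x
      ... | no y≢x  = there (to (P-x⇔∈ y) (y∈P , y≢x))
      from′ : ∀ y → y ∈ (x ∷ xs) → P y
      from′ y (here refl)  = x∈P
      from′ y (there y∈xs) = proj₁ (from (P-x⇔∈ y) y∈xs)

    HasCard-∞-remove : {P : Sub E} {x : E} → P x → HasCard P ∞ → HasCard (P - x) ∞
    HasCard-∞-remove x∈P infinite n = infinite (suc n) ∘ HasSize-insert x∈P

    unique-remove : {x : E} {xs : List E} → x ∈ xs → Unique xs →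
                    Σ (List E) λ ys → Unique ys × (∀ y → y ∈ ys ⇔ (y ∈ xs × y ≢ x)) ×
                                      suc (length ys) ≡ length xs
    unique-remove {xs = _ ∷ xs} (here refl) (x∉xs ∷ unique) = xs , unique , (λ y → mk⇔ to from) , refl
      where
      to : ∀ {y} → y ∈ xs → y ∈ (_ ∷ xs) × y ≢ _
      to y∈xs = there y∈xs , λ y≡x → All.lookup x∉xs y∈xs (sym y≡x)
      from : ∀ {y} → y ∈ (_ ∷ xs) × y ≢ _ → y ∈ xs
      from (here refl , y≢x) = ⊥-elim (y≢x refl)
      from (there y∈xs , _) = y∈xs
    unique-remove {x} {z ∷ xs} (there x∈xs) (z∉xs ∷ unique) with unique-remove x∈xs unique
    ... | ys , unique′ , ys⇔ , len =
      z ∷ ys , All.tabulate (All.lookup z∉xs ∘ proj₁ ∘ Equivalence.to (ys⇔ _)) ∷ unique′ ,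
      (λ y → mk⇔ to from) , cong suc len
      where
      to : ∀ {y} → y ∈ (z ∷ ys) → y ∈ (z ∷ xs) × y ≢ x
      to (here refl)  = here refl , All.lookup z∉xs x∈xs
      to (there y∈ys) = let y∈xs , y≢x = Equivalence.to (ys⇔ _) y∈ys in there y∈xs , y≢x
      from : ∀ {y} → y ∈ (z ∷ xs) × y ≢ x → y ∈ (z ∷ ys)
      from (here refl , _)     = here refl
      from (there y∈xs , y≢x) = there (Equivalence.from (ys⇔ _) (y∈xs , y≢x))

    HasSize-remove : {P : Sub E} {x : E} {n : ℕ} → P x → HasSize P (suc n) → HasSize (P - x) n
    HasSize-remove {P} {x} x∈P (xs , unique , P⇔∈ , len) with unique-remove (Equivalence.to (P⇔∈ x) x∈P) unique
    ... | ys , unique′ , ys⇔ , len′ = ys , unique′ , (λ y → mk⇔ to′ from′) , suc-injective (trans len′ len)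
      where
      open Equivalence
      to′ : ∀ {y} → (P - x) y → y ∈ ys
      to′ (y∈P , y≢x) = from (ys⇔ _) (to (P⇔∈ _) y∈P , y≢x)
      from′ : ∀ {y} → y ∈ ys → (P - x) y
      from′ y∈ys = let y∈xs , y≢x = to (ys⇔ _) y∈ys in from (P⇔∈ _) y∈xs , y≢x

  module _ {E A : Set} where

    LambdaSet : IndSys E → (A → Sub E) → Sub E → Set₁
    LambdaSet ind X S = Σ (A → Sub E) λ I → (∀ a → IsBasisOf ind (X a) (I a)) ×
                                             IsBasisOf (dualInd (restrictInd ind (⋃ I))) (⋃ I) S

    lambda-intro : {ind : IndSys E} {X : A → Sub E} {S : Sub E} {v : ℕ∞} →
                   LambdaSet ind X S → HasCard S v → LambdaIs ind X v
    lambda-intro (I , I-bases , S-basis) S-card = I , I-bases , _ , S-basis , S-card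

  -- Bases, closure, duality and contraction

  module Basics {E : Set} (M : Matroid E) where

    -- For independent I, this is membership in cl_M(I).
    Spans : Sub E → E → Set₁
    Spans I x = I x ⊎ ¬ ind M (I ∪ ｛ x ｝)

    basis-cong : {Y K K′ : Sub E} → K ⊆ K′ → K′ ⊆ K → IsBasisOf (ind M) Y K → IsBasisOf (ind M) Y K′
    basis-cong K⊆K′ K′⊆K (K⊆Y , iK , max) =
      (λ x → K⊆Y x ∘ K′⊆K x) , I2 M _ _ iK K′⊆K ,
      λ B K′⊆B B⊆Y iB x x∈B → K⊆K′ x (max B (λ y → K′⊆B y ∘ K⊆K′ y) B⊆Y iB x x∈B)

    remove-not-maximal : {B : Sub E} {x : E} → ind M B → B x → ¬ IsMaximal (ind M) (B - x)
    remove-not-maximal iB x∈B (_ , _ , max) = proj₂ (max _ (λ _ → proj₁) (λ _ _ → tt) iB _ x∈B) refl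

    extend-to-basis : {I Y : Sub E} → ind M I → I ⊆ Y → Σ (Sub E) λ K → I ⊆ K × IsBasisOf (ind M) Y K
    extend-to-basis = IM M _ _

    basis-exists : (Y : Sub E) → Σ (Sub E) (IsBasisOf (ind M) Y)
    basis-exists Y = let K , _ , K-basis = extend-to-basis (I1 M) (λ _ ()) in K , K-basis

    basis-of-spanning-maximal : {B Y K : Sub E} → IsMaximal (ind M) B → B ⊆ Y →
                                IsBasisOf (ind M) Y K → IsMaximal (ind M) K
    basis-of-spanning-maximal {B} maxB B⊆Y K-basis@(K⊆Y , iK , _) =
      (λ _ _ → tt) , iK , λ B′ K⊆B′ _ iB′ x x∈B′ → by-contradiction λ x∉K →
        let K-not-maximal = not-maximal (ind M) x∉K (I2 M _ B′ iB′ (insert-⊆ K⊆B′ x∈B′))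
            y , y∈B , y∉K , iKy = I3 M _ B iK K-not-maximal maxB
        in y∉K (basis-absorbs (ind M) K-basis (B⊆Y y y∈B) iKy)

    spans-trans : {I I′ : Sub E} {w : E} → ind M I → ind M I′ → (∀ y → I′ y → Spans I y) →
                  ¬ ind M (I′ ∪ ｛ w ｝) → Spans I w
    spans-trans {I} {I′} {w} iI iI′ I′⊆clI dep with dec (I w) | dec₁ (ind M (I ∪ ｛ w ｝))
    ... | yes w∈I | _        = inj₁ w∈I
    ... | no _    | no depIw = inj₂ depIw
    ... | no w∉I  | yes iIw  =
      let B , I+w⊆B , maxB@(_ , iB , _) = extend-to-basis iIw (λ _ _ → tt)
          K , I′⊆K , K-basis@(K⊆B∪I′ , iK , _) = extend-to-basis {Y = B ∪ I′} iI′ (λ _ → inj₂)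
          w∈B = I+w⊆B w (inj₂ refl)
          x , x∈K , x∉B-w , iBx = I3 M (B - w) K (I2 M _ B iB (λ _ → proj₁)) (remove-not-maximal iB w∈B)
                                    (basis-of-spanning-maximal maxB (λ _ → inj₁) K-basis)
          x∉B : ¬ B x
          x∉B x∈B = x∉B-w (x∈B , λ x≡w → dep (I2 M _ K iK (insert-⊆ I′⊆K (subst K x≡w x∈K))))
          I+x⊆B-w+x : (I ∪ ｛ x ｝) ⊆ ((B - w) ∪ ｛ x ｝)
          I+x⊆B-w+x = λ { y (inj₁ y∈I) → inj₁ (I+w⊆B y (inj₁ y∈I) , λ { refl → w∉I y∈I })
                        ; y (inj₂ refl) → inj₂ refl }
      in case K⊆B∪I′ x x∈K of λ
           { (inj₁ x∈B)  → ⊥-elim (x∉B x∈B)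
           ; (inj₂ x∈I′) → case I′⊆clI x x∈I′ of λ
               { (inj₁ x∈I)   → ⊥-elim (x∉B (I+w⊆B x (inj₁ x∈I)))
               ; (inj₂ depIx) → ⊥-elim (depIx (I2 M _ _ iBx I+x⊆B-w+x)) } }

    Spans⇒InCl : {I : Sub E} {x : E} → ind M I → Spans I x → InCl (ind M) I x
    Spans⇒InCl _  (inj₁ x∈I)  = inj₁ (lift x∈I)
    Spans⇒InCl iI (inj₂ depIx) = inj₂ (_ , (λ _ y∈I → y∈I) , iI , depIx)

    basis-spans : {Y K : Sub E} → IsBasisOf (ind M) Y K → ∀ y → Y y → Spans K y
    basis-spans K-basis y y∈Y with dec₁ (ind M (_ ∪ ｛ y ｝))
    ... | yes iKy  = inj₁ (basis-absorbs (ind M) K-basis y∈Y iKy)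
    ... | no depKy = inj₂ depKy

    maximal-spans : {B : Sub E} → IsMaximal (ind M) B → ∀ x → Spans B x
    maximal-spans maxB x = basis-spans maxB x tt

    spanning-maximal : {K : Sub E} → ind M K → (∀ x → Spans K x) → IsMaximal (ind M) K
    spanning-maximal {K} iK spans = (λ _ _ → tt) , iK , absorb
      where
      absorb : ∀ B → K ⊆ B → B ⊆ full → ind M B → B ⊆ K
      absorb B K⊆B _ iB x x∈B with spans x
      ... | inj₁ x∈K  = x∈K
      ... | inj₂ depKx = ⊥-elim (depKx (I2 M _ B iB (insert-⊆ K⊆B x∈B)))

    spans-cl : {Y K : Sub E} {x : E} → ind M K → (∀ y → Y y → Spans K y) → InCl (ind M) Y x → Spans K x
    spans-cl _  Y⊆spanK (inj₁ (lift x∈Y))           = Y⊆spanK _ x∈Y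
    spans-cl iK Y⊆spanK (inj₂ (I , I⊆Y , iI , dep)) = spans-trans iK iI (λ u → Y⊆spanK u ∘ I⊆Y u) dep

    InCl⇒Spans : {I : Sub E} {x : E} → ind M I → InCl (ind M) I x → Spans I x
    InCl⇒Spans iI = spans-cl iI (λ _ → inj₁)

    cl-mono : {Y Z : Sub E} {x : E} → Y ⊆ Z → InCl (ind M) Y x → InCl (ind M) Z x
    cl-mono Y⊆Z (inj₁ (lift x∈Y))           = inj₁ (lift (Y⊆Z _ x∈Y))
    cl-mono Y⊆Z (inj₂ (I , I⊆Y , iI , dep)) = inj₂ (I , (λ u → Y⊆Z u ∘ I⊆Y u) , iI , dep)

    cl-trans : {Y Z : Sub E} {x : E} → (∀ y → Y y → InCl (ind M) Z y) → InCl (ind M) Y x → InCl (ind M) Z x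
    cl-trans {Z = Z} Y⊆clZ x∈clY =
      let K , K-basis@(K⊆Z , iK , _) = basis-exists Z
          Y⊆spanK = λ y y∈Y → spans-cl iK (basis-spans K-basis) (Y⊆clZ y y∈Y)
      in cl-mono K⊆Z (Spans⇒InCl iK (spans-cl iK Y⊆spanK x∈clY))

    -- Excluded middle truncates the Set₁-valued InCl to a Set-valued predicate.
    cl : Sub E → Sub E
    cl Y x = True (dec₁ (InCl (ind M) Y x))

    cl-flat : (Y : Sub E) → IsFlat (ind M) (cl Y)
    cl-flat Y x x∈clclY = fromWitness (cl-trans (λ _ → toWitness) x∈clclY)

    ⊆-cl : {Y : Sub E} → Y ⊆ cl Y
    ⊆-cl y y∈Y = fromWitness (inj₁ (lift y∈Y))

    dual-basis-from-maximal : {B B₀ Y Z : Sub E} → IsMaximal (ind M) B → IsBasisOf (ind M) Z B₀ → B₀ ⊆ B →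
                              Disjoint B₀ Y → (∀ x → ¬ Y x → Z x) →
                              IsBasisOf (dualInd (ind M)) Y (λ x → Y x × ¬ B x)
    dual-basis-from-maximal {B} {B₀} {Y} maxB@(_ , iB , _) B₀-basis B₀⊆B B₀∩Y=∅ ∁Y⊆Z =
      (λ _ → proj₁) , (B , maxB , λ _ → proj₂) , absorb
      where
      absorb : ∀ C → (λ x → Y x × ¬ B x) ⊆ C → C ⊆ Y → dualInd (ind M) C → C ⊆ (λ x → Y x × ¬ B x)
      absorb C Y∖B⊆C C⊆Y (B′ , maxB′ , C∩B′=∅) x x∈C = x∈Y , λ x∈B →
        let y , y∈B′ , y∉B-x , iB-x+y =
              I3 M (B - x) B′ (I2 M _ B iB (λ _ → proj₁)) (remove-not-maximal iB x∈B) maxB′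
            y∉B : ¬ B y
            y∉B y∈B = y∉B-x (y∈B , λ y≡x → C∩B′=∅ x x∈C (subst B′ y≡x y∈B′))
            B₀⊆B-x : B₀ ⊆ (B - x)
            B₀⊆B-x u u∈B₀ = B₀⊆B u u∈B₀ , λ u≡x → B₀∩Y=∅ u u∈B₀ (subst Y (sym u≡x) x∈Y)
        in case dec (Y y) of λ
             { (yes y∈Y) → C∩B′=∅ y (Y∖B⊆C y (y∈Y , y∉B)) y∈B′
             ; (no y∉Y)  → y∉B (B₀⊆B y (basis-absorbs (ind M) B₀-basis (∁Y⊆Z y y∉Y)
                                          (I2 M _ _ iB-x+y (insert-mono B₀⊆B-x)))) }
        where
        x∈Y = C⊆Y x x∈C

    dual-basis-complement : {Y C K : Sub E} → IsBasisOf (dualInd (ind M)) Y C → IsBasisOf (ind M) (∁ C) K →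
                            IsMaximal (ind M) K × (∀ x → Y x → ¬ C x → K x)
    dual-basis-complement {C = C} {K} C-basis@(_ , (B , maxB , C∩B=∅) , _) K-basis@(K⊆∁C , _ , _) =
      maxK , λ x x∈Y x∉C → by-contradiction λ x∉K →
        x∉C (basis-absorbs (dualInd (ind M)) C-basis x∈Y (K , maxK , C+x∩K=∅ x∉K))
      where
      maxK = basis-of-spanning-maximal maxB (λ x x∈B x∈C → C∩B=∅ x x∈C x∈B) K-basis
      C+x∩K=∅ : ∀ {x} → ¬ K x → Disjoint (C ∪ ｛ x ｝) K
      C+x∩K=∅ _   u (inj₁ u∈C)  u∈K = K⊆∁C u u∈K u∈C
      C+x∩K=∅ x∉K u (inj₂ refl) u∈K = x∉K u∈K

    maximal-from-dual-basis : {Y B₀ C : Sub E} → IsBasisOf (ind M) (∁ Y) B₀ → IsBasisOf (dualInd (ind M)) Y C →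
                              IsMaximal (ind M) (B₀ ∪ (λ x → Y x × ¬ C x))
    maximal-from-dual-basis {Y} {B₀} {C} B₀-basis@(B₀⊆∁Y , iB₀ , _) C-basis@(C⊆Y , _ , _)
      with extend-to-basis iB₀ (λ x x∈B₀ x∈C → B₀⊆∁Y x x∈B₀ (C⊆Y x x∈C))
    ... | K , B₀⊆K , K-basis@(K⊆∁C , iK , _) = basis-cong K⊆B₀∪Y∖C B₀∪Y∖C⊆K maxK
      where
      maxK = proj₁ (dual-basis-complement C-basis K-basis)
      K⊆B₀∪Y∖C : K ⊆ (B₀ ∪ (λ x → Y x × ¬ C x))
      K⊆B₀∪Y∖C k k∈K with dec (Y k)
      ... | yes k∈Y = inj₂ (k∈Y , K⊆∁C k k∈K)
      ... | no k∉Y  = inj₁ (basis-absorbs (ind M) B₀-basis k∉Y (I2 M _ K iK (insert-⊆ B₀⊆K k∈K)))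
      B₀∪Y∖C⊆K : (B₀ ∪ (λ x → Y x × ¬ C x)) ⊆ K
      B₀∪Y∖C⊆K x (inj₁ x∈B₀)         = B₀⊆K x x∈B₀
      B₀∪Y∖C⊆K x (inj₂ (x∈Y , x∉C)) = proj₂ (dual-basis-complement C-basis K-basis) x x∈Y x∉C

    dual-basis-exists : (Y : Sub E) → Σ (Sub E) (IsBasisOf (dualInd (ind M)) Y)
    dual-basis-exists Y =
      let B₀ , B₀-basis@(B₀⊆∁Y , iB₀ , _) = basis-exists (∁ Y)
          B , B₀⊆B , maxB = extend-to-basis iB₀ (λ _ _ → tt)
      in _ , dual-basis-from-maximal maxB B₀-basis B₀⊆B B₀⊆∁Y (λ _ y∉Y → y∉Y)

    contract-ind-intro : {F B₀ I : Sub E} → IsBasisOf (ind M) F B₀ → Disjoint I F → ind M (I ∪ B₀) →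
                         contractInd (ind M) F I
    contract-ind-intro B₀-basis@(B₀⊆F , _ , _) I∩F=∅ iI∪B₀ =
      let B , I∪B₀⊆B , maxB = extend-to-basis iI∪B₀ (λ _ _ → tt)
          ∁F∖B-basis = dual-basis-from-maximal maxB B₀-basis (λ x → I∪B₀⊆B x ∘ inj₂)
                         (λ x x∈B₀ x∉F → x∉F (B₀⊆F x x∈B₀)) (λ _ → by-contradiction)
      in I∩F=∅ , _ , basis⇒restrict-maximal (dualInd (ind M)) ∁F∖B-basis ,
         λ x x∈I (_ , x∉B) → x∉B (I∪B₀⊆B x (inj₁ x∈I))

    contract-ind-elim : {F B₀ I : Sub E} → IsBasisOf (ind M) F B₀ → contractInd (ind M) F I → ind M (I ∪ B₀)
    contract-ind-elim {F} {B₀} {I} (B₀⊆F , iB₀ , _) (I∩F=∅ , C , maxC , I∩C=∅)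
      with restrict-maximal⇒basis (dualInd (ind M)) maxC
    ... | C-basis@(C⊆∁F , _) with extend-to-basis iB₀ (λ x x∈B₀ x∈C → C⊆∁F x x∈C (B₀⊆F x x∈B₀))
    ...   | K , B₀⊆K , K-basis = I2 M _ K (maxK .proj₂ .proj₁) I∪B₀⊆K
      where
      maxK = proj₁ (dual-basis-complement C-basis K-basis)
      I∪B₀⊆K : (I ∪ B₀) ⊆ K
      I∪B₀⊆K x (inj₁ x∈I)  = proj₂ (dual-basis-complement C-basis K-basis) x (I∩F=∅ x x∈I) (I∩C=∅ x x∈I)
      I∪B₀⊆K x (inj₂ x∈B₀) = B₀⊆K x x∈B₀

    corank-basis⇒maximal : {Y B₀ S : Sub E} → IsBasisOf (ind M) (∁ Y) B₀ →
                           IsBasisOf (dualInd (restrictInd (dualInd (ind M)) Y)) Y S → IsMaximal (ind M) (B₀ ∪ S)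
    corank-basis⇒maximal {Y} {B₀} {S} B₀-basis S-basis@(S⊆Y , _)
      with restrict-dual-basis-elim (dualInd (ind M)) S-basis
    ... | C , C-basis , S∩C=∅ , Y∖C⊆S =
      basis-cong B₀∪Y∖C⊆B₀∪S B₀∪S⊆B₀∪Y∖C (maximal-from-dual-basis B₀-basis C-basis)
      where
      B₀∪Y∖C⊆B₀∪S : (B₀ ∪ (λ x → Y x × ¬ C x)) ⊆ (B₀ ∪ S)
      B₀∪Y∖C⊆B₀∪S x (inj₁ x∈B₀)         = inj₁ x∈B₀
      B₀∪Y∖C⊆B₀∪S x (inj₂ (x∈Y , x∉C)) = inj₂ (Y∖C⊆S x x∈Y x∉C)
      B₀∪S⊆B₀∪Y∖C : (B₀ ∪ S) ⊆ (B₀ ∪ (λ x → Y x × ¬ C x))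
      B₀∪S⊆B₀∪Y∖C x (inj₁ x∈B₀) = inj₁ x∈B₀
      B₀∪S⊆B₀∪Y∖C x (inj₂ x∈S)  = inj₂ (S⊆Y x x∈S , S∩C=∅ x x∈S)

    maximal⇒corank-basis : {Y B₀ S : Sub E} → IsBasisOf (ind M) (∁ Y) B₀ → S ⊆ Y → IsMaximal (ind M) (B₀ ∪ S) →
                           IsBasisOf (dualInd (restrictInd (dualInd (ind M)) Y)) Y S
    maximal⇒corank-basis {Y} {B₀} {S} B₀-basis@(B₀⊆∁Y , _) S⊆Y maxB₀∪S =
      restrict-dual-basis-intro (dualInd (ind M))
        (dual-basis-from-maximal maxB₀∪S B₀-basis (λ _ → inj₁) B₀⊆∁Y (λ _ y∉Y → y∉Y))
        S⊆Y (λ x x∈S (_ , x∉B₀∪S) → x∉B₀∪S (inj₂ x∈S))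
        (λ x x∈Y x∉Y∖B₀∪S → by-contradiction λ x∉S →
           x∉Y∖B₀∪S (x∈Y , λ { (inj₁ x∈B₀) → B₀⊆∁Y x x∈B₀ x∈Y ; (inj₂ x∈S) → x∉S x∈S }))

    contract-basis-spans : {F Y K : Sub E} → IsBasisOf (contractInd (ind M) F) Y K → ∀ y → Y y → InCl (ind M) (F ∪ K) y
    contract-basis-spans {F} {Y} {K} K-basis@(_ , iK@(K∩F=∅ , _) , _) y y∈Y with dec (F y) | dec (K y) | basis-exists F
    ... | yes y∈F | _       | _ = inj₁ (lift (inj₁ y∈F))
    ... | no _    | yes y∈K | _ = inj₁ (lift (inj₂ y∈K))
    ... | no y∉F  | no y∉K  | B₀ , B₀-basis@(B₀⊆F , _) =
      inj₂ (K ∪ B₀ , K∪B₀⊆F∪K , contract-ind-elim B₀-basis iK ,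
            λ iK∪B₀+y → y∉K (basis-absorbs (contractInd (ind M) F) K-basis y∈Y
                               (contract-ind-intro B₀-basis K+y∩F=∅ (I2 M _ _ iK∪B₀+y K+y∪B₀⊆K∪B₀+y))))
      where
      K∪B₀⊆F∪K : (K ∪ B₀) ⊆ (F ∪ K)
      K∪B₀⊆F∪K x (inj₁ x∈K)  = inj₂ x∈K
      K∪B₀⊆F∪K x (inj₂ x∈B₀) = inj₁ (B₀⊆F x x∈B₀)
      K+y∩F=∅ : Disjoint (K ∪ ｛ y ｝) F
      K+y∩F=∅ x (inj₁ x∈K)  = K∩F=∅ x x∈K
      K+y∩F=∅ x (inj₂ refl) = y∉F
      K+y∪B₀⊆K∪B₀+y : ((K ∪ ｛ y ｝) ∪ B₀) ⊆ ((K ∪ B₀) ∪ ｛ y ｝)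
      K+y∪B₀⊆K∪B₀+y x (inj₁ (inj₁ x∈K)) = inj₁ (inj₁ x∈K)
      K+y∪B₀⊆K∪B₀+y x (inj₁ (inj₂ x≡y)) = inj₂ x≡y
      K+y∪B₀⊆K∪B₀+y x (inj₂ x∈B₀)       = inj₁ (inj₂ x∈B₀)

    loop-dependent : {x : E} → cl ∅ x → ¬ ind M (∅ ∪ ｛ x ｝)
    loop-dependent x∈cl∅ with InCl⇒Spans (I1 M) (toWitness x∈cl∅)
    ... | inj₁ ()
    ... | inj₂ dep = dep

    independent-avoids-loops : {I : Sub E} → ind M I → Disjoint I (cl ∅)
    independent-avoids-loops iI x x∈I x∈cl∅ = loop-dependent x∈cl∅ (I2 M _ _ iI (insert-⊆ (λ _ ()) x∈I))

    loops-basis : IsBasisOf (ind M) (cl ∅) ∅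
    loops-basis =
      (λ _ ()) , I1 M , λ B _ B⊆cl∅ iB x x∈B → ⊥-elim (independent-avoids-loops iB x x∈B (B⊆cl∅ x x∈B))

    contract-loops-ind : {I : Sub E} → ind M I → contractInd (ind M) (cl ∅) I
    contract-loops-ind iI = contract-ind-intro loops-basis (independent-avoids-loops iI) (I2 M _ _ iI I∪∅⊆I)
      where
      I∪∅⊆I : ∀ {I} → (I ∪ ∅) ⊆ I
      I∪∅⊆I x (inj₁ x∈I) = x∈I

    contract-loops-ind⁻¹ : {I : Sub E} → contractInd (ind M) (cl ∅) I → ind M I
    contract-loops-ind⁻¹ iI = I2 M _ _ (contract-ind-elim loops-basis iI) (λ _ → inj₁)

    spanning-basis-maximal : {Y K : Sub E} → (∀ x → InCl (ind M) Y x) → IsBasisOf (ind M) Y K → IsMaximal (ind M) K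
    spanning-basis-maximal Y-spans K-basis@(_ , iK , _) =
      spanning-maximal iK λ x → spans-cl iK (basis-spans K-basis) (Y-spans x)

    maximal-exchange-unique : {B K : Sub E} {e x y : E} → IsMaximal (ind M) B → IsMaximal (ind M) K →
                              K ⊆ (B ∪ ｛ e ｝) → B x → ¬ K x → B y → ¬ K y → y ≡ x
    maximal-exchange-unique {B} {K} {e} {x} {y} (_ , iB , _) maxK@(_ , _ , absorbK) K⊆B+e x∈B x∉K y∈B y∉K
      with I3 M (B - x) K (I2 M _ B iB (λ _ → proj₁)) (remove-not-maximal iB x∈B) maxK
    ... | z , z∈K , z∉B-x , iB-x+z =
      by-contradiction λ y≢x → y∉K (absorbK _ K⊆B-x+z (λ _ _ → tt) iB-x+z y (inj₁ (y∈B , y≢x)))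
      where
      z≡e : z ≡ e
      z≡e with K⊆B+e z z∈K
      ... | inj₁ z∈B = ⊥-elim (z∉B-x (z∈B , λ z≡x → x∉K (subst K z≡x z∈K)))
      ... | inj₂ z≡e = z≡e
      K⊆B-x+z : K ⊆ ((B - x) ∪ ｛ z ｝)
      K⊆B-x+z k k∈K with K⊆B+e k k∈K
      ... | inj₁ k∈B = inj₁ (k∈B , λ k≡x → x∉K (subst K k≡x k∈K))
      ... | inj₂ k≡e = inj₂ (trans k≡e (sym z≡e))

    lambda-zero-intro : {A : Set} {X : A → Sub E} {I : A → Sub E} → (∀ a → IsBasisOf (ind M) (X a) (I a)) →
                        ind M (⋃ I) → LambdaIs (ind M) X (fin 0)
    lambda-zero-intro I-bases i⋃I =
      lambda-intro {S = ∅}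
        (_ , I-bases , restrict-dual-basis-intro (ind M) (self-basis (ind M) i⋃I) (λ _ ()) (λ _ ())
                         (λ _ x∈⋃I x∉⋃I → ⊥-elim (x∉⋃I x∈⋃I)))
        (empty⇒HasSize-0 λ _ ())

    lambda-zero-elim : {A : Set} {X : A → Sub E} → LambdaIs (ind M) X (fin 0) →
                       Σ (A → Sub E) λ I → (∀ a → IsBasisOf (ind M) (X a) (I a)) × ind M (⋃ I)
    lambda-zero-elim (I , I-bases , S , S-basis , S=∅) with restrict-dual-basis-elim (ind M) S-basis
    ... | C , (_ , iC , _) , _ , ⋃I∖C⊆S =
      I , I-bases ,
      I2 M _ C iC λ x x∈⋃I → by-contradiction λ x∉C → HasSize-0⇒empty S=∅ x (⋃I∖C⊆S x x∈⋃I x∉C)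

  -- Partitions, cobases and skewness

  module Partition {E A : Set} (M : Matroid E) (X : A → Sub E) (part : IsPartition X) where
    open Basics M

    part-of : E → A
    part-of x = proj₁ (proj₁ part x)

    ∈-part-of : ∀ x → X (part-of x) x
    ∈-part-of x = proj₂ (proj₁ part x)

    part-unique : ∀ {a b x} → X a x → X b x → a ≡ b
    part-unique = proj₂ part _ _ _

    parts-meet-in-loops : (P : IndSys E) → ∀ a b → a ≢ b → ∀ x → (X a ∩ X b) x → InCl P ∅ x
    parts-meet-in-loops _ _ _ a≢b _ (x∈Xa , x∈Xb) = ⊥-elim (a≢b (part-unique x∈Xa x∈Xb))

    skew-contract-all-but-one : {F : Sub E} (a : A) → (∀ b → b ≢ a → X b ⊆ F) → Skew (contractInd (ind M) F) X
    skew-contract-all-but-one {F} a others⊆F with basis-exists F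
    ... | B₀ , B₀-basis@(B₀⊆F , iB₀ , _) with extend-to-basis iB₀ (λ _ _ → tt)
    ...   | B , B₀⊆B , maxB@(_ , iB , _) =
      (B∖F , contract-ind-intro B₀-basis (λ _ → proj₂) (I2 M _ B iB (∪B₀⊆B (λ _ → proj₁))) , bases) ,
      parts-meet-in-loops _
      where
      B∖F : Sub E
      B∖F x = B x × ¬ F x
      ∪B₀⊆B : {Z : Sub E} → Z ⊆ B → (Z ∪ B₀) ⊆ B
      ∪B₀⊆B Z⊆B x (inj₁ x∈Z)  = Z⊆B x x∈Z
      ∪B₀⊆B _   x (inj₂ x∈B₀) = B₀⊆B x x∈B₀
      ∉F⇒∈Xa : ∀ {y} → ¬ F y → X a y
      ∉F⇒∈Xa {y} y∉F with dec (part-of y ≡ a)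
      ... | yes refl = ∈-part-of y
      ... | no b≢a   = ⊥-elim (y∉F (others⊆F _ b≢a y (∈-part-of y)))
      bases : ∀ b → IsBasisOf (contractInd (ind M) F) (X b) (B∖F ∩ X b)
      bases b =
        (λ _ → proj₂) , contract-ind-intro B₀-basis (λ _ → proj₂ ∘ proj₁) (I2 M _ B iB (∪B₀⊆B (λ _ → proj₁ ∘ proj₁))) ,
        absorb
        where
        absorb : ∀ K → (B∖F ∩ X b) ⊆ K → K ⊆ X b → contractInd (ind M) F K → K ⊆ (B∖F ∩ X b)
        absorb K B∖F∩Xb⊆K K⊆Xb iK@(K∩F=∅ , _) x x∈K with dec (b ≡ a)
        ... | no b≢a   = ⊥-elim (K∩F=∅ x x∈K (others⊆F b b≢a x (K⊆Xb x x∈K)))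
        ... | yes refl = (proj₂ (proj₂ maxB) _ B⊆K∪B₀ (λ _ _ → tt) (contract-ind-elim B₀-basis iK) x (inj₁ x∈K) ,
                          K∩F=∅ x x∈K) , K⊆Xb x x∈K
          where
          B⊆K∪B₀ : B ⊆ (K ∪ B₀)
          B⊆K∪B₀ y y∈B with dec (F y)
          ... | yes y∈F = inj₂ (basis-absorbs (ind M) B₀-basis y∈F (I2 M _ B iB (insert-⊆ B₀⊆B y∈B)))
          ... | no y∉F  = inj₁ (B∖F∩Xb⊆K y ((y∈B , y∉F) , ∉F⇒∈Xa y∉F))

    skew-contract-cl-complement : (a : A) → Skew (contractInd (ind M) (cl (∁ (X a)))) X
    skew-contract-cl-complement a =
      skew-contract-all-but-one a λ b b≢a x x∈Xb → ⊆-cl x λ x∈Xa → b≢a (part-unique x∈Xb x∈Xa)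

    skew-contract-loops : {I : A → Sub E} → (∀ a → IsBasisOf (ind M) (X a) (I a)) → ind M (⋃ I) →
                          Skew (contractInd (ind M) (cl ∅)) X
    skew-contract-loops {I} I-bases i⋃I = (⋃ I , contract-loops-ind i⋃I , bases) , parts-meet-in-loops _
      where
      bases : ∀ a → IsBasisOf (contractInd (ind M) (cl ∅)) (X a) (⋃ I ∩ X a)
      bases a = (λ _ → proj₂) , contract-loops-ind (I2 M _ _ i⋃I (λ _ → proj₁)) , absorb
        where
        absorb : ∀ K → (⋃ I ∩ X a) ⊆ K → K ⊆ X a → contractInd (ind M) (cl ∅) K → K ⊆ (⋃ I ∩ X a)
        absorb K ⋃I∩Xa⊆K K⊆Xa iK x x∈K =
          let Ia⊆Xa , _ , absorbIa = I-bases a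
          in (a , absorbIa K (λ y y∈Ia → ⋃I∩Xa⊆K y ((a , y∈Ia) , Ia⊆Xa y y∈Ia)) K⊆Xa (contract-loops-ind⁻¹ iK) x x∈K) ,
             K⊆Xa x x∈K

    corank-exists : ∃[ v ] LambdaIs (dualInd (ind M)) X v
    corank-exists =
      let C , C-basis = dual-basis-exists (⋃ λ a → proj₁ (dual-basis-exists (X a)))
      in _ , lambda-intro (_ , (λ a → proj₂ (dual-basis-exists (X a))) ,
                           restrict-dual-basis-intro (dualInd (ind M)) C-basis (λ _ → proj₁) (λ _ → proj₂) (λ _ → _,_))
                          (proj₂ (HasCard-exists _))

    module Cobases {Ja : A → Sub E} (Ja-bases : ∀ a → IsBasisOf (dualInd (ind M)) (X a) (Ja a)) where

      J : Sub E
      J = ⋃ Ja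

      J∩part⊆cobasis : ∀ {a x} → X a x → J x → Ja a x
      J∩part⊆cobasis x∈Xa (b , x∈Jb) = subst (λ c → Ja c _) (part-unique (proj₁ (Ja-bases b) _ x∈Jb) x∈Xa) x∈Jb

      maximal-avoiding-J : {B : Sub E} → IsMaximal (ind M) B → Disjoint B J → ∀ a → IsBasisOf (ind M) (X a) (B ∩ X a)
      maximal-avoiding-J {B} maxB@(_ , iB , _) B∩J=∅ a =
        (λ _ → proj₂) , I2 M _ B iB (λ _ → proj₁) ,
        λ K B∩Xa⊆K K⊆Xa iK x x∈K → by-contradiction (λ x∉B → insert-absurd (K⊆Xa x x∈K) x∉B
                                      (I2 M _ K iK (insert-⊆ B∩Xa⊆K x∈K))) , K⊆Xa x x∈K
        where
        insert-absurd : ∀ {x} → X a x → ¬ B x → ind M ((B ∩ X a) ∪ ｛ x ｝) → ⊥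
        insert-absurd {x} x∈Xa x∉B iB∩Xa+x with extend-to-basis {Y = B ∪ ｛ x ｝} iB∩Xa+x (insert-mono (λ _ → proj₁))
        ... | K , B∩Xa+x⊆K , K-basis@(K⊆B+x , iK , _) = B⊈K (λ y y∈B → by-contradiction (missed-absurd y∈B))
          where
          maxK = basis-of-spanning-maximal maxB (λ _ → inj₁) K-basis
          B⊈K : ¬ (B ⊆ K)
          B⊈K B⊆K = x∉B (basis-absorbs (ind M) maxB tt (I2 M _ K iK (insert-⊆ B⊆K (B∩Xa+x⊆K x (inj₂ refl)))))
          missed-absurd : ∀ {y} → B y → ¬ K y → ⊥
          missed-absurd {y} y∈B y∉K =
            B∩J=∅ y y∈B (part-of y , basis-absorbs (dualInd (ind M)) (Ja-bases _) (∈-part-of y) (K , maxK , Jb+y∩K=∅))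
            where
            y∉Xa : ¬ X a y
            y∉Xa y∈Xa = y∉K (B∩Xa+x⊆K y (inj₁ (y∈B , y∈Xa)))
            Jb+y∩K=∅ : Disjoint (Ja (part-of y) ∪ ｛ y ｝) K
            Jb+y∩K=∅ u (inj₂ refl) u∈K = y∉K u∈K
            Jb+y∩K=∅ u (inj₁ u∈Jb) u∈K with K⊆B+x u u∈K
            ... | inj₁ u∈B  = B∩J=∅ u u∈B (_ , u∈Jb)
            ... | inj₂ refl = y∉Xa (subst (λ c → X c y) (part-unique (proj₁ (Ja-bases _) u u∈Jb) x∈Xa) (∈-part-of y))

      lambda-zero-of-corank-zero : {S : Sub E} → IsBasisOf (dualInd (restrictInd (dualInd (ind M)) J)) J S →
                                   HasSize S 0 → LambdaIs (ind M) X (fin 0)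
      lambda-zero-of-corank-zero {S} S-basis S=∅ with basis-exists (∁ J)
      ... | B₀ , B₀-basis@(B₀⊆∁J , _) =
        lambda-zero-intro (maximal-avoiding-J maxB₀ B₀⊆∁J)
                          (I2 M _ B₀ (proj₁ (proj₂ maxB₀)) λ { _ (_ , x∈B₀ , _) → x∈B₀ })
        where
        B₀∪S⊆B₀ : (B₀ ∪ S) ⊆ B₀
        B₀∪S⊆B₀ x (inj₁ x∈B₀) = x∈B₀
        B₀∪S⊆B₀ x (inj₂ x∈S)  = ⊥-elim (HasSize-0⇒empty S=∅ x x∈S)
        maxB₀ : IsMaximal (ind M) B₀
        maxB₀ = basis-cong B₀∪S⊆B₀ (λ _ → inj₁) (corank-basis⇒maximal B₀-basis S-basis)

      -- Take a basis B of M avoiding J a. Points of B in another part X b lie in cl(F ∪ (B′ ∩ X b)), and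
      -- points of B in X a avoid J, so lie in F. Hence x ∈ cl(B) ⊆ cl(F ∪ (B′ ∖ X a)), contradicting the
      -- independence of B′ in M / F.
      contract-basis-avoids-parts : {F B′ : Sub E} → ∁ J ⊆ F → contractInd (ind M) F B′ →
                                    (∀ b → IsBasisOf (contractInd (ind M) F) (X b) (B′ ∩ X b)) →
                                    ∀ {a x} → B′ x → X a x → ⊥
      contract-basis-avoids-parts {F} {B′} ∁J⊆F iB′@(B′∩F=∅ , _) B′-bases {a} {x} x∈B′ x∈Xa with basis-exists F
      ... | B₀ , B₀-basis@(B₀⊆F , iB₀ , _) = Z-avoids-x (InCl⇒Spans iZ x∈clZ)
        where
        iB′∪B₀ = contract-ind-elim B₀-basis iB′
        Z : Sub E
        Z = B₀ ∪ (λ y → B′ y × ¬ X a y)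
        Z⊆B′∪B₀ : Z ⊆ (B′ ∪ B₀)
        Z⊆B′∪B₀ y (inj₁ y∈B₀)       = inj₂ y∈B₀
        Z⊆B′∪B₀ y (inj₂ (y∈B′ , _)) = inj₁ y∈B′
        iZ = I2 M _ _ iB′∪B₀ Z⊆B′∪B₀
        x∉F = B′∩F=∅ x x∈B′
        Z-avoids-x : Spans Z x → ⊥
        Z-avoids-x (inj₁ (inj₁ x∈B₀))       = x∉F (B₀⊆F x x∈B₀)
        Z-avoids-x (inj₁ (inj₂ (_ , x∉Xa))) = x∉Xa x∈Xa
        Z-avoids-x (inj₂ dep)                = dep (I2 M _ _ iB′∪B₀ (insert-⊆ Z⊆B′∪B₀ (inj₁ x∈B′)))
        F⊆clZ : ∀ y → F y → InCl (ind M) Z y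
        F⊆clZ y y∈F = cl-mono (λ _ → inj₁) (Spans⇒InCl iB₀ (basis-spans B₀-basis y y∈F))
        other-part⊆clZ : ∀ {b} → b ≢ a → ∀ y → (F ∪ (B′ ∩ X b)) y → InCl (ind M) Z y
        other-part⊆clZ _   y (inj₁ y∈F)           = F⊆clZ y y∈F
        other-part⊆clZ b≢a y (inj₂ (y∈B′ , y∈Xb)) =
          inj₁ (lift (inj₂ (y∈B′ , λ y∈Xa → b≢a (part-unique y∈Xb y∈Xa))))
        x∈clZ : InCl (ind M) Z x
        x∈clZ with proj₁ (proj₂ (Ja-bases a))
        ... | B , maxB@(_ , iB , _) , Ja∩B=∅ = cl-trans B⊆clZ (Spans⇒InCl iB (maximal-spans maxB x))
          where
          B⊆clZ : ∀ y → B y → InCl (ind M) Z y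
          B⊆clZ y y∈B with dec (part-of y ≡ a)
          ... | yes refl = F⊆clZ y (∁J⊆F y λ y∈J → Ja∩B=∅ y (J∩part⊆cobasis (∈-part-of y) y∈J) y∈B)
          ... | no b≢a   = cl-trans (other-part⊆clZ b≢a) (contract-basis-spans (B′-bases _) y (∈-part-of y))

      skew-contraction-spans : {F : Sub E} → ∁ J ⊆ F → Skew (contractInd (ind M) F) X → ∀ x → InCl (ind M) F x
      skew-contraction-spans {F} ∁J⊆F ((B′ , iB′ , B′-bases) , _) x =
        cl-mono drop-B′ (contract-basis-spans (B′-bases _) x (∈-part-of x))
        where
        drop-B′ : ∀ {b} → (F ∪ (B′ ∩ X b)) ⊆ F
        drop-B′ y (inj₁ y∈F)           = y∈F
        drop-B′ y (inj₂ (y∈B′ , y∈Xb)) = ⊥-elim (contract-basis-avoids-parts ∁J⊆F iB′ B′-bases y∈B′ y∈Xb)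

    corank-zero⇒lambda-zero : LambdaIs (dualInd (ind M)) X (fin 0) → LambdaIs (ind M) X (fin 0)
    corank-zero⇒lambda-zero (_ , Ja-bases , _ , S-basis , S=∅) = Cobases.lambda-zero-of-corank-zero Ja-bases S-basis S=∅

  -- One guts projection

  module GutsProjectionStep {E A : Set} {X : A → Sub E} (part : IsPartition X) (M N : Matroid E)
                            (projection : IsGutsProjection M X N) where
    open Basics M
    open Partition M X part

    M′ : Matroid (Maybe E)
    M′ = proj₁ projection

    module M′ = Basics M′
    module N = Basics N

    deletion : ∀ I → ind M I ⇔ ind M′ (liftSub I)
    deletion = proj₁ (proj₂ projection)

    guts-cut : ∀ F → IsFlat (ind M) F → (InCl (ind M′) (liftSub F) nothing ⇔ InGutsCut (ind M) X F)
    guts-cut = proj₁ (proj₂ (proj₂ projection))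

    contraction : ∀ I → ind N I ⇔ contractInd (ind M′) ｛ nothing ｝ (liftSub I)
    contraction = proj₂ (proj₂ (proj₂ projection))

    lift-ind : {I : Sub E} → ind M I → ind M′ (liftSub I)
    lift-ind = Equivalence.to (deletion _)

    unlift-ind : {Z : Sub (Maybe E)} → ind M′ Z → ind M (Z ∘ just)
    unlift-ind iZ = Equivalence.from (deletion _) (I2 M′ _ _ iZ unlift-⊆)

    lift-cl : {Y : Sub E} {x : E} → InCl (ind M) Y x → InCl (ind M′) (liftSub Y) (just x)
    lift-cl (inj₁ (lift x∈Y))                = inj₁ (lift x∈Y)
    lift-cl {x = x} (inj₂ (I , I⊆Y , iI , dep)) =
      inj₂ (liftSub I , lift-mono I⊆Y , lift-ind iI , λ i → dep (I2 M _ _ (unlift-ind i) I+x⊆))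
      where
      I+x⊆ : (I ∪ ｛ x ｝) ⊆ ((liftSub I ∪ ｛ just x ｝) ∘ just)
      I+x⊆ _ (inj₁ y∈I)  = inj₁ y∈I
      I+x⊆ _ (inj₂ refl) = inj₂ refl

    e∈cl-of-skew : {F : Sub E} → IsFlat (ind M) F → Skew (contractInd (ind M) F) X →
                   InCl (ind M′) (liftSub F) nothing
    e∈cl-of-skew F-flat skew = Equivalence.from (guts-cut _ F-flat) (F-flat , skew)

    skew-of-e∈cl : {F : Sub E} → IsFlat (ind M) F → InCl (ind M′) (liftSub F) nothing →
                   Skew (contractInd (ind M) F) X
    skew-of-e∈cl F-flat e∈clF = proj₂ (Equivalence.to (guts-cut _ F-flat) e∈clF)

    lift-cl-of-cl : {Y : Sub E} → ∀ z → liftSub (cl Y) z → InCl (ind M′) (liftSub Y) z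
    lift-cl-of-cl (just y) y∈clY = lift-cl (toWitness y∈clY)

    e∈cl-complement-part : (a : A) → InCl (ind M′) (liftSub (∁ (X a))) nothing
    e∈cl-complement-part a = M′.cl-trans lift-cl-of-cl (e∈cl-of-skew (cl-flat _) (skew-contract-cl-complement a))

    lift-maximal : {B : Sub E} → InCl (ind M′) (liftSub full) nothing → IsMaximal (ind M) B →
                   IsMaximal (ind M′) (liftSub B)
    lift-maximal {B} e∈clE maxB@(_ , iB , _) =
      M′.spanning-maximal (lift-ind iB) λ z → M′.InCl⇒Spans (lift-ind iB) (M′.cl-trans E⊆clB (ground z))
      where
      ground : ∀ z → InCl (ind M′) (liftSub full) z
      ground (just x) = inj₁ (lift tt)
      ground nothing  = e∈clE
      E⊆clB : ∀ z → liftSub full z → InCl (ind M′) (liftSub B) z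
      E⊆clB (just x) _ = lift-cl (Spans⇒InCl iB (maximal-spans maxB x))

    unlift-maximal : {K : Sub (Maybe E)} → IsMaximal (ind M′) K → ¬ K nothing → IsMaximal (ind M) (K ∘ just)
    unlift-maximal {K} (_ , iK , absorbK) e∉K =
      (λ _ _ → tt) , unlift-ind iK ,
      λ B K⊆B _ iB x x∈B → absorbK (liftSub B) (K⊆liftB K⊆B) (λ _ _ → tt) (lift-ind iB) (just x) x∈B
      where
      K⊆liftB : ∀ {B} → (K ∘ just) ⊆ B → K ⊆ liftSub B
      K⊆liftB K⊆B (just x) x∈K = K⊆B x x∈K
      K⊆liftB _   nothing  e∈K = ⊥-elim (e∉K e∈K)

    module NonLoop (e-independent : ind M′ ｛ nothing ｝) where

      e-basis : IsBasisOf (ind M′) ｛ nothing ｝ ｛ nothing ｝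
      e-basis = (λ _ z≡e → z≡e) , e-independent , λ _ _ B⊆e _ → B⊆e

      contract-ind⇔ : {I : Sub E} → ind N I ⇔ ind M′ (liftSub I ∪ ｛ nothing ｝)
      contract-ind⇔ {I} =
        mk⇔ (λ iI → M′.contract-ind-elim e-basis (Equivalence.to (contraction I) iI))
            (λ i → Equivalence.from (contraction I) (M′.contract-ind-intro e-basis liftI∩e=∅ i))
        where
        liftI∩e=∅ : Disjoint (liftSub I) ｛ nothing ｝
        liftI∩e=∅ (just _) _ ()

      contract-maximal : {K : Sub (Maybe E)} → IsMaximal (ind M′) K → K nothing → IsMaximal (ind N) (K ∘ just)
      contract-maximal {K} (_ , iK , absorbK) e∈K =
        (λ _ _ → tt) , Equivalence.from contract-ind⇔ (I2 M′ _ K iK (unlift-insert-⊆ e∈K)) ,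
        λ B K⊆B _ iB x x∈B →
          absorbK _ (K⊆liftB+e K⊆B) (λ _ _ → tt) (Equivalence.to contract-ind⇔ iB) (just x) (inj₁ x∈B)
        where
        K⊆liftB+e : ∀ {B} → (K ∘ just) ⊆ B → K ⊆ (liftSub B ∪ ｛ nothing ｝)
        K⊆liftB+e K⊆B (just x) x∈K = inj₁ (K⊆B x x∈K)
        K⊆liftB+e _   nothing  _   = inj₂ refl

      uncontract-maximal : {B : Sub E} → IsMaximal (ind N) B → IsMaximal (ind M′) (liftSub B ∪ ｛ nothing ｝)
      uncontract-maximal {B} (_ , iB , absorbB) = (λ _ _ → tt) , Equivalence.to contract-ind⇔ iB , absorb
        where
        absorb : ∀ Z → (liftSub B ∪ ｛ nothing ｝) ⊆ Z → Z ⊆ full → ind M′ Z → Z ⊆ (liftSub B ∪ ｛ nothing ｝)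
        absorb Z B+e⊆Z _ iZ (just x) x∈Z =
          inj₁ (absorbB (Z ∘ just) (λ y y∈B → B+e⊆Z (just y) (inj₁ y∈B)) (λ _ _ → tt)
                  (Equivalence.from contract-ind⇔ (I2 M′ _ Z iZ (unlift-insert-⊆ (B+e⊆Z nothing (inj₂ refl))))) x x∈Z)
        absorb Z _ _ _ nothing _ = inj₂ refl

    module Step {Ja : A → Sub E} (Ja-bases : ∀ a → IsBasisOf (dualInd (ind M)) (X a) (Ja a))
                {S : Sub E} (S-basis : IsBasisOf (dualInd (restrictInd (dualInd (ind M)) (⋃ Ja))) (⋃ Ja) S)
                {x₀ : E} (x₀∈S : S x₀) where
      open Cobases Ja-bases

      S⊆J : S ⊆ J
      S⊆J = proj₁ S-basis

      B₀ : Sub E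
      B₀ = proj₁ (basis-exists (∁ J))

      B₀-basis : IsBasisOf (ind M) (∁ J) B₀
      B₀-basis = proj₂ (basis-exists (∁ J))

      maxB₀∪S : IsMaximal (ind M) (B₀ ∪ S)
      maxB₀∪S = corank-basis⇒maximal B₀-basis S-basis

      x₀∉cl∁J : ¬ InCl (ind M) (∁ J) x₀
      x₀∉cl∁J x₀∈cl with spans-cl (proj₁ (proj₂ B₀-basis)) (basis-spans B₀-basis) x₀∈cl
      ... | inj₁ x₀∈B₀ = proj₁ B₀-basis x₀ x₀∈B₀ (S⊆J x₀ x₀∈S)
      ... | inj₂ dep   = dep (I2 M _ _ (proj₁ (proj₂ maxB₀∪S)) (insert-⊆ (λ _ → inj₁) (inj₂ x₀∈S)))

      e∉cl∁J : ¬ InCl (ind M′) (liftSub (∁ J)) nothing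
      e∉cl∁J e∈cl∁J =
        x₀∉cl∁J (cl-trans (λ _ → toWitness)
                   (skew-contraction-spans ⊆-cl (skew-of-e∈cl (cl-flat _) (M′.cl-mono (lift-mono ⊆-cl) e∈cl∁J)) x₀))

      lambda-nonzero : ¬ LambdaIs (ind M) X (fin 0)
      lambda-nonzero λ=0 with lambda-zero-elim λ=0
      ... | _ , I-bases , i⋃I =
        e∉cl∁J (M′.cl-trans loops⊆cl∁J (e∈cl-of-skew (cl-flat ∅) (skew-contract-loops I-bases i⋃I)))
        where
        loops⊆cl∁J : ∀ z → liftSub (cl ∅) z → InCl (ind M′) (liftSub (∁ J)) z
        loops⊆cl∁J z z∈cl∅ = M′.cl-mono (lift-mono λ _ ()) (lift-cl-of-cl z z∈cl∅)

      B₀+e-independent : ind M′ (liftSub B₀ ∪ ｛ nothing ｝)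
      B₀+e-independent = by-contradiction₁ λ dep →
        e∉cl∁J (inj₂ (liftSub B₀ , lift-mono (proj₁ B₀-basis) , lift-ind (proj₁ (proj₂ B₀-basis)) , dep))

      e-independent : ind M′ ｛ nothing ｝
      e-independent = I2 M′ _ _ B₀+e-independent (λ _ → inj₂)

      open NonLoop e-independent

      e∈cl-ground : InCl (ind M′) (liftSub full) nothing
      e∈cl-ground = M′.cl-mono (lift-mono λ _ _ → tt) (e∈cl-complement-part (part-of x₀))

      contract-maximal-below : {B : Sub E} → IsMaximal (ind M) B → Σ (Sub E) λ B′ → IsMaximal (ind N) B′ × B′ ⊆ B
      contract-maximal-below {B} maxB with M′.extend-to-basis {Y = liftSub B ∪ ｛ nothing ｝} e-independent (λ _ → inj₂)
      ... | K , e⊆K , K-basis@(K⊆B+e , _) =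
        K ∘ just ,
        contract-maximal (M′.basis-of-spanning-maximal (lift-maximal e∈cl-ground maxB) (λ _ → inj₁) K-basis)
                         (e⊆K nothing refl) ,
        K⊆B
        where
        K⊆B : (K ∘ just) ⊆ B
        K⊆B x x∈K with K⊆B+e (just x) x∈K
        ... | inj₁ x∈B = x∈B

      dual-ind-M⇒N : {D : Sub E} → dualInd (ind M) D → dualInd (ind N) D
      dual-ind-M⇒N (B , maxB , D∩B=∅) =
        let B′ , maxB′ , B′⊆B = contract-maximal-below maxB
        in B′ , maxB′ , λ x x∈D x∈B′ → D∩B=∅ x x∈D (B′⊆B x x∈B′)

      -- As e ∈ cl(E ∖ X a) ⊆ cl(E ∖ D), the spanning set (E ∖ D) + e of M′ makes E ∖ D spanning.
      dual-ind-N⇒M : ∀ {a} {D : Sub E} → D ⊆ X a → dualInd (ind N) D → dualInd (ind M) D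
      dual-ind-N⇒M {a} {D} D⊆Xa (B , maxB , D∩B=∅) = from-basis (M′.basis-exists (liftSub (∁ D)))
        where
        maxB+e = uncontract-maximal maxB
        B+e⊆cl∁D : ∀ z → (liftSub B ∪ ｛ nothing ｝) z → InCl (ind M′) (liftSub (∁ D)) z
        B+e⊆cl∁D (just x) (inj₁ x∈B) = inj₁ (lift λ x∈D → D∩B=∅ x x∈D x∈B)
        B+e⊆cl∁D _        (inj₂ refl) =
          M′.cl-mono (lift-mono λ x x∉Xa x∈D → x∉Xa (D⊆Xa x x∈D)) (e∈cl-complement-part a)
        ∁D-spans : ∀ z → InCl (ind M′) (liftSub (∁ D)) z
        ∁D-spans z = M′.cl-trans B+e⊆cl∁D (M′.Spans⇒InCl (proj₁ (proj₂ maxB+e)) (M′.maximal-spans maxB+e z))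
        from-basis : Σ (Sub (Maybe E)) (IsBasisOf (ind M′) (liftSub (∁ D))) → dualInd (ind M) D
        from-basis (K , K-basis@(K⊆∁D , _)) =
          K ∘ just , unlift-maximal (M′.spanning-basis-maximal ∁D-spans K-basis) (K⊆∁D nothing) ,
          λ x x∈D x∈K → K⊆∁D (just x) x∈K x∈D

      Ja-bases-N : ∀ a → IsBasisOf (dualInd (ind N)) (X a) (Ja a)
      Ja-bases-N a =
        let Ja⊆Xa , iJa , absorb = Ja-bases a
        in Ja⊆Xa , dual-ind-M⇒N iJa , λ D Ja⊆D D⊆Xa iD → absorb D Ja⊆D D⊆Xa (dual-ind-N⇒M D⊆Xa iD)

      maxB₀∪S′ : IsMaximal (ind M′) (liftSub (B₀ ∪ S))
      maxB₀∪S′ = lift-maximal e∈cl-ground maxB₀∪S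

      K-extension : Σ (Sub (Maybe E)) λ K → (liftSub B₀ ∪ ｛ nothing ｝) ⊆ K ×
                                            IsBasisOf (ind M′) (liftSub (B₀ ∪ S) ∪ ｛ nothing ｝) K
      K-extension = M′.extend-to-basis B₀+e-independent (insert-mono (lift-mono λ _ → inj₁))

      K : Sub (Maybe E)
      K = proj₁ K-extension

      B₀+e⊆K : (liftSub B₀ ∪ ｛ nothing ｝) ⊆ K
      B₀+e⊆K = proj₁ (proj₂ K-extension)

      K⊆B₀∪S+e : K ⊆ (liftSub (B₀ ∪ S) ∪ ｛ nothing ｝)
      K⊆B₀∪S+e = proj₁ (proj₂ (proj₂ K-extension))

      maxK : IsMaximal (ind M′) K
      maxK = M′.basis-of-spanning-maximal maxB₀∪S′ (λ _ → inj₁) (proj₂ (proj₂ K-extension))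

      e∈K : K nothing
      e∈K = B₀+e⊆K nothing (inj₂ refl)

      S⊈K : Σ E λ x → S x × ¬ K (just x)
      S⊈K = by-contradiction λ S⊆K →
        not-maximal (ind M′) (λ ()) (I2 M′ _ K (proj₁ (proj₂ maxK)) (B₀∪S+e⊆K S⊆K)) maxB₀∪S′
        where
        B₀∪S+e⊆K : ¬ Σ E (λ x → S x × ¬ K (just x)) → (liftSub (B₀ ∪ S) ∪ ｛ nothing ｝) ⊆ K
        B₀∪S+e⊆K _    (just x) (inj₁ (inj₁ x∈B₀)) = B₀+e⊆K (just x) (inj₁ x∈B₀)
        B₀∪S+e⊆K S⊆K (just x) (inj₁ (inj₂ x∈S))  = by-contradiction λ x∉K → S⊆K (x , x∈S , x∉K)
        B₀∪S+e⊆K _    _        (inj₂ refl)         = e∈K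

      x₁ : E
      x₁ = proj₁ S⊈K

      x₁∈S : S x₁
      x₁∈S = proj₁ (proj₂ S⊈K)

      x₁∉K : ¬ K (just x₁)
      x₁∉K = proj₂ (proj₂ S⊈K)

      x₁-unique : ∀ {y} → S y → ¬ K (just y) → y ≡ x₁
      x₁-unique y∈S y∉K =
        just-injective (M′.maximal-exchange-unique maxB₀∪S′ maxK K⊆B₀∪S+e (inj₂ x₁∈S) x₁∉K (inj₂ y∈S) y∉K)

      K⊆B₀∪S-x₁ : (K ∘ just) ⊆ (B₀ ∪ (S - x₁))
      K⊆B₀∪S-x₁ x x∈K = classify (K⊆B₀∪S+e (just x) x∈K)
        where
        classify : (liftSub (B₀ ∪ S) ∪ ｛ nothing ｝) (just x) → (B₀ ∪ (S - x₁)) x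
        classify (inj₁ (inj₁ x∈B₀)) = inj₁ x∈B₀
        classify (inj₁ (inj₂ x∈S))  = inj₂ (x∈S , λ x≡x₁ → x₁∉K (subst (K ∘ just) x≡x₁ x∈K))
        classify (inj₂ ())

      B₀∪S-x₁⊆K : (B₀ ∪ (S - x₁)) ⊆ (K ∘ just)
      B₀∪S-x₁⊆K x (inj₁ x∈B₀)         = B₀+e⊆K (just x) (inj₁ x∈B₀)
      B₀∪S-x₁⊆K x (inj₂ (x∈S , x≢x₁)) = by-contradiction λ x∉K → x≢x₁ (x₁-unique x∈S x∉K)

      B₀-basis-N : IsBasisOf (ind N) (∁ J) B₀
      B₀-basis-N =
        proj₁ B₀-basis , Equivalence.from contract-ind⇔ B₀+e-independent ,
        λ B B₀⊆B B⊆∁J iB → proj₂ (proj₂ B₀-basis) B B₀⊆B B⊆∁J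
                             (I2 M _ _ (unlift-ind (Equivalence.to contract-ind⇔ iB)) (λ _ → inj₁))

      corank-basis-N : IsBasisOf (dualInd (restrictInd (dualInd (ind N)) J)) J (S - x₁)
      corank-basis-N =
        N.maximal⇒corank-basis B₀-basis-N (λ x → S⊆J x ∘ proj₁)
          (N.basis-cong K⊆B₀∪S-x₁ B₀∪S-x₁⊆K (contract-maximal maxK e∈K))

    corank-step : {S : Sub E} → LambdaSet (dualInd (ind M)) X S → {x₀ : E} → S x₀ →
                  ¬ LambdaIs (ind M) X (fin 0) × Σ E λ x₁ → S x₁ × LambdaSet (dualInd (ind N)) X (S - x₁)
    corank-step (Ja , Ja-bases , S-basis) x₀∈S =
      let open Step Ja-bases S-basis x₀∈S
      in lambda-nonzero , x₁ , x₁∈S , Ja , Ja-bases-N , corank-basis-N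

    corank-suc : {n : ℕ} → LambdaIs (dualInd (ind M)) X (fin (suc n)) →
                 ¬ LambdaIs (ind M) X (fin 0) × LambdaIs (dualInd (ind N)) X (fin n)
    corank-suc (Ja , Ja-bases , S , S-basis , S-size) =
      let λ≢0 , x₁ , x₁∈S , S-x₁-set = corank-step (Ja , Ja-bases , S-basis) (proj₂ (HasSize-suc⇒nonempty S-size))
      in λ≢0 , lambda-intro S-x₁-set (HasSize-remove x₁∈S S-size)

    corank-∞ : LambdaIs (dualInd (ind M)) X ∞ → ¬ LambdaIs (ind M) X (fin 0) × LambdaIs (dualInd (ind N)) X ∞
    corank-∞ (Ja , Ja-bases , S , S-basis , S-infinite) =
      let λ≢0 , x₁ , x₁∈S , S-x₁-set = corank-step (Ja , Ja-bases , S-basis) (proj₂ (HasCard-∞⇒nonempty S-infinite))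
      in λ≢0 , lambda-intro S-x₁-set (HasCard-∞-remove x₁∈S S-infinite)

  module _ {E A : Set} {X : A → Sub E} (part : IsPartition X) where
    open GutsProjectionStep part using (corank-suc; corank-∞)

    min-zero-fin : (n : ℕ) (Ms : ℕ → Matroid E) → (∀ k → IsGutsProjection (Ms k) X (Ms (suc k))) →
                   LambdaIs (dualInd (ind (Ms 0))) X (fin n) → MinZeroSpec Ms X (fin n)
    min-zero-fin zero    Ms _  λ*=0   = Partition.corank-zero⇒lambda-zero (Ms 0) X part λ*=0 , λ _ ()
    min-zero-fin (suc n) Ms gp λ*=1+n =
      let λ₀≢0 , λ*₁=n = corank-suc (Ms 0) (Ms 1) (gp 0) λ*=1+n
          λ₁₊ₙ=0 , λ₁₊ₖ≢0 = min-zero-fin n (Ms ∘ suc) (gp ∘ suc) λ*₁=n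
      in λ₁₊ₙ=0 , λ { zero _ → λ₀≢0 ; (suc k) (s≤s k<n) → λ₁₊ₖ≢0 k k<n }

    min-zero-∞ : (Ms : ℕ → Matroid E) → (∀ k → IsGutsProjection (Ms k) X (Ms (suc k))) →
                 LambdaIs (dualInd (ind (Ms 0))) X ∞ → MinZeroSpec Ms X ∞
    min-zero-∞ Ms gp λ*=∞ zero    = proj₁ (corank-∞ (Ms 0) (Ms 1) (gp 0) λ*=∞)
    min-zero-∞ Ms gp λ*=∞ (suc k) = min-zero-∞ (Ms ∘ suc) (gp ∘ suc) (proj₂ (corank-∞ (Ms 0) (Ms 1) (gp 0) λ*=∞)) k

mainTheorem14 : ExcludedMiddle (lsuc (lsuc 0ℓ)) →
    (E A : Set) (M : Matroid E) (X : A → Sub E) → IsPartition X →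
    (Ms : ℕ → Matroid E) → Ms zero ≡ M →
    (∀ k → IsGutsProjection (Ms k) X (Ms (suc k))) →
    (∃[ v ] LambdaIs (dualInd (ind M)) X v) ×
    (∀ v → LambdaIs (dualInd (ind M)) X v → MinZeroSpec Ms X v)
mainTheorem14 em E A M X part Ms refl gp =
  Partition.corank-exists em M X part ,
  λ { (fin n) → min-zero-fin em part n Ms gp
    ; ∞       → min-zero-∞ em part Ms gp }
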